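{- Let $q$ be a prime power, $n,m,k$ positive integers with $nm>k$, and let $U$ be an $nm$-dimensional $\mathbb{F}_q$-subspace of $\mathbb{F}_{q^n}^k$ with $\langle U\rangle_{\mathbb{F}_{q^n}}=\mathbb{F}_{q^n}^k$. If $U$ is indecomposable, then its Delsarte dual (an $nm$-dimensional $\mathbb{F}_q$-subspace of $\mathbb{F}_{q^n}^{nm-k}$) is indecomposable.
   Context: An $\mathbb{F}_q$-subspace $U$ of $V=\mathbb{F}_{q^n}^t$ is decomposable if there exist nonzero $\mathbb{F}_{q^n}$-subspaces $V_1,V_2$ of $V$ with $V=V_1\oplus V_2$ and $U=(U\cap V_1)\oplus(U\cap V_2)$, and indecomposable otherwise. Delsarte dual: let $U$ be an $M$-dimensional $\mathbb{F}_q$-subspace of $V=\mathbb{F}_{q^n}^k$ with $M>k$ and $\langle U\rangle_{\mathbb{F}_{q^n}}=V$. There exist an $M$-dimensional $\mathbb{F}_{q^n}$-space $Z$, an $M$-dimensional $\mathbb{F}_q$-subspace $W$ of $Z$ with $\langle W\rangle_{\mathbb{F}_{q^n}}=Z$, and an $(M-k)$-dimensional $\mathbb{F}_{q^n}$-subspace $\Gamma$ of $Z$ with $W\cap\Gamma=\{0\}$, such that an $\mathbb{F}_{q^n}$-isomorphism $Z/\Gamma\to V$ maps $(W+\Gamma)/\Gamma$ onto $U$. Take a nondegenerate $\mathbb{F}_q$-bilinear form $\beta'$ on $W$, extend it $\mathbb{F}_{q^n}$-bilinearly to a nondegenerate form $\beta$ on $Z$, and let $\Gamma^\perp$ be the orthogonal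 complement of $\Gamma$ with respect to $\beta$. The Delsarte dual of $U$ is the $\mathbb{F}_q$-subspace $(W+\Gamma^\perp)/\Gamma^\perp$ of $Z/\Gamma^\perp\cong\mathbb{F}_{q^n}^{M-k}$; up to $\mathrm{GL}(M-k,q^n)$-equivalence it does not depend on the choices made. -}

module Defs where

open import Level using (0ℓ)
open import Data.Nat using (ℕ; zero; suc; _^_; _≥_)
open import Data.Nat.Primality using (Prime)
open import Data.Fin using (Fin)
open import Data.Product using (Σ; ∃; ∃-syntax; _×_; _,_)
open import Relation.Nullary using (¬_)
open import Relation.Binary.PropositionalEquality using (_≡_; _≢_)
open import Algebra.Structures using (IsCommutativeRing)
open import Function.Bundles using (_↔_)
open import Function.Definitions using (Injective)

IsPrimePower : ℕ → Set
IsPrimePower q = ∃[ p ] ∃[ e ] (Prime p × e ≥ 1 × q ≡ p ^ e)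

record Field : Set₁ where
  infixl 6 _+_
  infixl 7 _*_
  field
    Carrier : Set
    _+_ _*_ : Carrier → Carrier → Carrier
    -_ : Carrier → Carrier
    0# 1# : Carrier
    isCommutativeRing : IsCommutativeRing _≡_ _+_ _*_ -_ 0# 1#
    0≢1 : 0# ≢ 1#
    inverse : ∀ x → x ≢ 0# → ∃[ y ] (x * y ≡ 1#)

-- A finite field F of order q^n (playing F_{q^n}) together with a subfield K
-- of order q (playing F_q), given by an injective enumeration ι : Fin q → F.
record FieldExt (q n : ℕ) : Set₁ where
  field
    F : Field
  open Field F public
  field
    card : Carrier ↔ Fin (q ^ n)
    ι : Fin q → Carrier
    ι-inj : Injective _≡_ _≡_ ι
  K : Carrier → Set
  K x = ∃[ i ] (ι i ≡ x)
  field
    K-0 : K 0#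
    K-1 : K 1#
    K-+ : ∀ {x y} → K x → K y → K (x + y)
    K-* : ∀ {x y} → K x → K y → K (x * y)
    K-neg : ∀ {x} → K x → K (- x)
    K-inv : ∀ {x y} → K x → x * y ≡ 1# → K y

module LinAlg {q n : ℕ} (E : FieldExt q n) where
  open FieldExt E

  Vec : ℕ → Set
  Vec t = Fin t → Carrier

  0v : ∀ {t} → Vec t
  0v _ = 0#

  _⊕v_ : ∀ {t} → Vec t → Vec t → Vec t
  (u ⊕v v) i = u i + v i

  _·v_ : ∀ {t} → Carrier → Vec t → Vec t
  (c ·v v) i = c * v i

  _≋_ : ∀ {t} → Vec t → Vec t → Set
  u ≋ v = ∀ i → u i ≡ v i

  Σ[<_] : ∀ r → (Fin r → Carrier) → Carrier
  Σ[< zero ] f = 0#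
  Σ[< suc r ] f = f Fin.zero + Σ[< r ] (λ i → f (Fin.suc i))

  lincomb : ∀ {t r} → (Fin r → Carrier) → (Fin r → Vec t) → Vec t
  lincomb {r = r} c v j = Σ[< r ] (λ i → c i * v i j)

  _▷_ : ∀ {t r} → (Fin t → Fin r → Carrier) → Vec r → Vec t
  (A ▷ z) i = lincomb z (λ j i' → A i' j) i

  InK : ∀ {t} → Vec t → Set
  InK v = ∀ i → K (v i)

  record IsFSubspace {t} (S : Vec t → Set) : Set where
    field
      resp : ∀ {u v} → u ≋ v → S u → S v
      has0 : S 0v
      closed+ : ∀ {u v} → S u → S v → S (u ⊕v v)
      closed· : ∀ c {v} → S v → S (c ·v v)

  record IsKSubspace {t} (S : Vec t → Set) : Set where
    field
      resp : ∀ {u v} → u ≋ v → S u → S v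
      has0 : S 0v
      closed+ : ∀ {u v} → S u → S v → S (u ⊕v v)
      closed· : ∀ {c v} → K c → S v → S (c ·v v)

  HasKDim : ∀ {t} → (Vec t → Set) → ℕ → Set
  HasKDim {t} S d = Σ (Fin d → Vec t) λ b →
      (∀ i → S (b i))
    × (∀ c → InK c → lincomb c b ≋ 0v → ∀ i → c i ≡ 0#)
    × (∀ u → S u → ∃[ c ] (InK c × u ≋ lincomb c b))

  FSpansAll : ∀ {t} → (Vec t → Set) → Set
  FSpansAll {t} S = ∀ v → ∃[ r ] Σ (Fin r → Vec t) λ u →
      (∀ i → S (u i)) × ∃[ c ] (v ≋ lincomb c u)

  NonZero : ∀ {t} → (Vec t → Set) → Set
  NonZero S = ∃[ v ] (S v × ¬ (v ≋ 0v))

  Decomposable : ∀ t → (Vec t → Set) → Set₁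
  Decomposable t U = ∃[ V₁ ] ∃[ V₂ ]
      ( IsFSubspace {t} V₁ × IsFSubspace {t} V₂
      × NonZero V₁ × NonZero V₂
      × (∀ v → V₁ v → V₂ v → v ≋ 0v)
      × (∀ v → ∃[ v₁ ] ∃[ v₂ ] (V₁ v₁ × V₂ v₂ × v ≋ (v₁ ⊕v v₂)))
      × (∀ u → U u → ∃[ u₁ ] ∃[ u₂ ]
            (U u₁ × V₁ u₁ × U u₂ × V₂ u₂ × u ≋ (u₁ ⊕v u₂))))

  Indecomposable : ∀ t → (Vec t → Set) → Set₁
  Indecomposable t U = ¬ Decomposable t U

  -- F_{q^n}-bilinear extension to F^M of the F_q-bilinear form on W = F_q^M
  -- with Gram matrix B (entries in F_q):  β(x,y) = Σ_i Σ_j x_i B_ij y_j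
  bil : ∀ {M} → (Fin M → Fin M → Carrier) → Vec M → Vec M → Carrier
  bil {M} B x y = Σ[< M ] (λ i → Σ[< M ] (λ j → x i * B i j * y j))

  -- The data of a Delsarte-dual construction for U ⊆ F^k, with
  -- Z = F^M, W = F_q^M ⊆ Z, ψ = G : Z → V (so Γ = ker G, Z/Γ ≅ V),
  -- β with Gram matrix B, and φ = H : Z → F^(M-k) with kernel Γ^⊥
  -- (so Z/Γ^⊥ ≅ F^(M-k)).
  record DelsarteData (k M k' : ℕ) (U : Vec k → Set) : Set where
    field
      G : Fin k → Fin M → Carrier
      G-surj : ∀ v → ∃[ z ] ((G ▷ z) ≋ v)
      G-W-into : ∀ w → InK w → U (G ▷ w)
      G-W-onto : ∀ u → U u → ∃[ w ] (InK w × (G ▷ w) ≋ u)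
      W∩Γ≡0 : ∀ w → InK w → (G ▷ w) ≋ 0v → w ≋ 0v
      B : Fin M → Fin M → Carrier
      B-K : ∀ i j → K (B i j)
      B-nondeg : ∀ x → InK x → (∀ y → InK y → bil B x y ≡ 0#) → x ≋ 0v
      H : Fin k' → Fin M → Carrier
      H-surj : ∀ v → ∃[ z ] ((H ▷ z) ≋ v)
      H-ker→ : ∀ z → (H ▷ z) ≋ 0v → ∀ γ → (G ▷ γ) ≋ 0v → bil B z γ ≡ 0#
      H-ker← : ∀ z → (∀ γ → (G ▷ γ) ≋ 0v → bil B z γ ≡ 0#) → (H ▷ z) ≋ 0v

    -- the Delsarte dual (W + Γ^⊥)/Γ^⊥ seen inside F^(k')
    Dual : Vec k' → Set
    Dual v = ∃[ w ] (InK w × (H ▷ w) ≋ v)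

module Submission where

-- Suppose the dual H(W) split as V₁ ⊕ V₂. Lifting the projection π₁ onto V₁ through H gives an
-- F_q-rational map P of F^M with H P = π₁ H; it preserves Γ⊥ = ker H, and it is idempotent
-- because H is injective on W. The β-adjoint Q of P then preserves Γ⊥⊥ = Γ = ker G,
-- so it induces an idempotent π of F^k = F^M / Γ mapping U into itself, which is neither 0 nor 1
-- since P is neither; the fixed points and the kernel of π decompose U.
-- Injectivity of H on W comes from indecomposability as well: for a nonzero w ∈ W ∩ Γ⊥,
-- β(w, ·) descends to a linear functional on F^k that is F_q-valued and nonzero on U, and
-- projecting U onto a line along its kernel decomposes U, since dim U = nm ≥ 2.

open import Level using (0ℓ)
open import Data.Nat using (ℕ; zero; suc; _^_; _≤_; s≤s)
open import Data.Nat.Properties using (n≮n; ≤-trans)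
open import Data.Fin as Fin using (Fin; zero; suc; punchOut; combine; funToFin; finToFun)
open import Data.Fin.Properties
  using (all?; any?; ¬∀⟶∃¬; punchOut-injective; injective⇒≤; finToFun-funToFin; funToFin-finToFin)
open import Data.Product using (Σ; _×_; _,_; proj₁; proj₂; ∃; ∃-syntax)
open import Data.Empty using (⊥-elim)
open import Function using (_∘_)
open import Function.Definitions using (Injective)
open import Function.Properties.Inverse using (↔⇒↣)
open import Relation.Nullary using (¬_; Dec; yes; no)
open import Relation.Nullary.Decidable using (via-injection)
open import Relation.Binary.PropositionalEquality
  using (_≡_; _≢_; refl; sym; trans; cong; cong₂; subst; setoid; module ≡-Reasoning)
open import Algebra.Bundles using (CommutativeRing)
open import Defs

Fin-injective⇒surjective : ∀ {N} (f : Fin N → Fin N) → Injective _≡_ _≡_ f →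
                           ∀ y → ∃[ x ] (f x ≡ y)
Fin-injective⇒surjective {zero}  f f-inj ()
Fin-injective⇒surjective {suc N} f f-inj y with any? (λ x → f x Fin.≟ y)
... | yes hit  = hit
... | no  miss = ⊥-elim (n≮n N (injective⇒≤ squeezed-injective))
  where
  y≢f : ∀ x → y ≢ f x
  y≢f x y≡fx = miss (x , sym y≡fx)

  squeezed-injective : Injective _≡_ _≡_ (λ x → punchOut (y≢f x))
  squeezed-injective eq = f-inj (punchOut-injective (y≢f _) (y≢f _) eq)

funToFin-cong : ∀ {m n} {f g : Fin m → Fin n} → (∀ i → f i ≡ g i) → funToFin f ≡ funToFin g
funToFin-cong {zero}  f≗g = refl
funToFin-cong {suc m} f≗g = cong₂ combine (f≗g zero) (funToFin-cong (f≗g ∘ suc))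

funToFin-injective : ∀ {m n} {f g : Fin m → Fin n} → funToFin f ≡ funToFin g → ∀ i → f i ≡ g i
funToFin-injective {f = f} {g} eq i =
  trans (sym (finToFun-funToFin f i)) (trans (cong (λ c → finToFun c i) eq) (finToFun-funToFin g i))

module LinearAlgebra {q n : ℕ} (E : FieldExt q n) where
  open FieldExt E
  open LinAlg E

  commutativeRing : CommutativeRing 0ℓ 0ℓ
  commutativeRing = record { isCommutativeRing = isCommutativeRing }

  open CommutativeRing commutativeRing
    using (+-assoc; +-comm; +-identityˡ; +-identityʳ; *-assoc; *-comm; *-identityˡ; *-identityʳ;
           distribˡ; distribʳ; zeroˡ; zeroʳ; -‿inverseʳ; semiring; ring; +-commutativeSemigroup)
  open import Algebra.Properties.Ring ring using (-1*x≈-x; x∙y⁻¹≈ε⇒x≈y)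
  open import Algebra.Properties.CommutativeSemigroup +-commutativeSemigroup using (interchange)
  open import Algebra.Properties.Semiring.Sum semiring
    using (sum; sum-cong-≗; ∑-distrib-+; ∑-comm; *-distribˡ-sum; *-distribʳ-sum; sum-replicate-zero)
  open import Data.Vec.Functional.Relation.Binary.Equality.Setoid (setoid Carrier)
    using (≋-refl; ≋-sym; ≋-trans)

  infix 4 _≟_ _≋?_
  _≟_ : (x y : Carrier) → Dec (x ≡ y)
  _≟_ = via-injection (↔⇒↣ card) Fin._≟_

  _≋?_ : ∀ {t} (u v : Vec t) → Dec (u ≋ v)
  u ≋? v = all? (λ i → u i ≟ v i)

  x-y≡0⇒x≡y : ∀ {x y} → x + - 1# * y ≡ 0# → x ≡ y
  x-y≡0⇒x≡y {x} {y} eq = x∙y⁻¹≈ε⇒x≈y x y (trans (cong (x +_) (sym (-1*x≈-x y))) eq)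

  x-x≡0 : ∀ x → x + - 1# * x ≡ 0#
  x-x≡0 x = trans (cong (x +_) (-1*x≈-x x)) (-‿inverseʳ x)

  x+[y-x]≡y : ∀ x y → x + (y + - 1# * x) ≡ y
  x+[y-x]≡y x y = begin
    x + (y + - 1# * x)  ≡⟨ cong (x +_) (+-comm y _) ⟩
    x + (- 1# * x + y)  ≡⟨ +-assoc x _ y ⟨
    x + - 1# * x + y    ≡⟨ cong (_+ y) (x-x≡0 x) ⟩
    0# + y              ≡⟨ +-identityˡ y ⟩
    y                   ∎
    where open ≡-Reasoning

  x+y≡x'+y'⇒x-x'≡y'-y : ∀ {x y x' y'} → x + y ≡ x' + y' → x + - 1# * x' ≡ y' + - 1# * y
  x+y≡x'+y'⇒x-x'≡y'-y {x} {y} {x'} {y'} eq = begin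
    x + - 1# * x'                           ≡⟨ +-identityʳ _ ⟨
    x + - 1# * x' + 0#                      ≡⟨ cong (x + - 1# * x' +_) (x-x≡0 y) ⟨
    x + - 1# * x' + (y + - 1# * y)          ≡⟨ interchange x _ y _ ⟩
    x + y + (- 1# * x' + - 1# * y)          ≡⟨ cong (_+ (- 1# * x' + - 1# * y)) eq ⟩
    x' + y' + (- 1# * x' + - 1# * y)        ≡⟨ interchange x' y' _ _ ⟩
    x' + - 1# * x' + (y' + - 1# * y)        ≡⟨ cong (_+ (y' + - 1# * y)) (x-x≡0 x') ⟩
    0# + (y' + - 1# * y)                    ≡⟨ +-identityˡ _ ⟩
    y' + - 1# * y                           ∎
    where open ≡-Reasoning

  xy-yx≡0 : ∀ x y → x * y + - 1# * y * x ≡ 0#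
  xy-yx≡0 x y = trans (cong (x * y +_) (trans (*-assoc _ y x) (cong (- 1# *_) (*-comm y x)))) (x-x≡0 (x * y))

  -- Subtraction is u + (- 1) v, so that linear maps preserve it by ⊕-homo and ·-homo alone.
  _⊖v_ : ∀ {t} → Vec t → Vec t → Vec t
  u ⊖v v = u ⊕v ((- 1#) ·v v)

  ⊖v-≋0⇒≋ : ∀ {t} {u v : Vec t} → (u ⊖v v) ≋ 0v → u ≋ v
  ⊖v-≋0⇒≋ h i = x-y≡0⇒x≡y (h i)

  ⊖v-self : ∀ {t} (u : Vec t) → (u ⊖v u) ≋ 0v
  ⊖v-self u i = x-x≡0 (u i)

  ⊕v-cong : ∀ {t} {u u' v v' : Vec t} → u ≋ u' → v ≋ v' → (u ⊕v v) ≋ (u' ⊕v v')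
  ⊕v-cong hu hv i = cong₂ _+_ (hu i) (hv i)

  ·v-cong : ∀ {t} c {u v : Vec t} → u ≋ v → (c ·v u) ≋ (c ·v v)
  ·v-cong c h i = cong (c *_) (h i)

  e : ∀ {r} → Fin r → Vec r
  e zero    zero    = 1#
  e zero    (suc _) = 0#
  e (suc _) zero    = 0#
  e (suc j) (suc i) = e j i

  e-sym : ∀ {r} (i j : Fin r) → e i j ≡ e j i
  e-sym zero    zero    = refl
  e-sym zero    (suc j) = refl
  e-sym (suc i) zero    = refl
  e-sym (suc i) (suc j) = e-sym i j

  _ᵀ : ∀ {t r} → (Fin t → Fin r → Carrier) → Fin r → Fin t → Carrier
  (A ᵀ) i j = A j i

  mat : ∀ {t r} → (Fin r → Vec t) → Fin t → Fin r → Carrier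
  mat columns i j = columns j i

  dot : ∀ {r} → Vec r → Vec r → Carrier
  dot x y = sum (λ i → x i * y i)

  Σ≡sum : ∀ r (f : Fin r → Carrier) → Σ[< r ] f ≡ sum f
  Σ≡sum zero    f = refl
  Σ≡sum (suc r) f = cong (f zero +_) (Σ≡sum r (f ∘ suc))

  ▷-dot : ∀ {t r} (A : Fin t → Fin r → Carrier) x i → (A ▷ x) i ≡ dot x (A i)
  ▷-dot {r = r} A x i = Σ≡sum r _

  dot-comm : ∀ {r} (x y : Vec r) → dot x y ≡ dot y x
  dot-comm x y = sum-cong-≗ (λ i → *-comm (x i) (y i))

  dot-cong : ∀ {r} {x x' y y' : Vec r} → x ≋ x' → y ≋ y' → dot x y ≡ dot x' y'
  dot-cong hx hy = sum-cong-≗ (λ i → cong₂ _*_ (hx i) (hy i))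

  dot-⊕ˡ : ∀ {r} (x x' y : Vec r) → dot (x ⊕v x') y ≡ dot x y + dot x' y
  dot-⊕ˡ x x' y = trans (sum-cong-≗ (λ i → distribʳ (y i) (x i) (x' i)))
                        (∑-distrib-+ (λ i → x i * y i) (λ i → x' i * y i))

  dot-·ˡ : ∀ {r} c (x y : Vec r) → dot (c ·v x) y ≡ c * dot x y
  dot-·ˡ c x y = trans (sum-cong-≗ (λ i → *-assoc c (x i) (y i))) (sym (*-distribˡ-sum c (λ i → x i * y i)))

  dot-0ˡ : ∀ {r} (y : Vec r) → dot 0v y ≡ 0#
  dot-0ˡ {r} y = trans (sum-cong-≗ (λ i → zeroˡ (y i))) (sum-replicate-zero r)

  dot-⊕ʳ : ∀ {r} (x y y' : Vec r) → dot x (y ⊕v y') ≡ dot x y + dot x y'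
  dot-⊕ʳ x y y' = trans (dot-comm x _) (trans (dot-⊕ˡ y y' x) (cong₂ _+_ (dot-comm y x) (dot-comm y' x)))

  dot-·ʳ : ∀ {r} c (x y : Vec r) → dot x (c ·v y) ≡ c * dot x y
  dot-·ʳ c x y = trans (dot-comm x _) (trans (dot-·ˡ c y x) (cong (c *_) (dot-comm y x)))

  dot-0ʳ : ∀ {r} (x : Vec r) → dot x 0v ≡ 0#
  dot-0ʳ x = trans (dot-comm x 0v) (dot-0ˡ x)

  dot-⊖ʳ : ∀ {r} (x y y' : Vec r) → dot x (y ⊖v y') ≡ dot x y + - 1# * dot x y'
  dot-⊖ʳ x y y' = trans (dot-⊕ʳ x y _) (cong (dot x y +_) (dot-·ʳ (- 1#) x y'))

  dot-eʳ : ∀ {r} (x : Vec r) j → dot x (e j) ≡ x j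
  dot-eʳ {suc r} x zero    = begin
    x zero * 1# + dot (x ∘ suc) 0v  ≡⟨ cong₂ _+_ (*-identityʳ _) (dot-0ʳ (x ∘ suc)) ⟩
    x zero + 0#                     ≡⟨ +-identityʳ _ ⟩
    x zero                          ∎
    where open ≡-Reasoning
  dot-eʳ {suc r} x (suc j) = begin
    x zero * 0# + dot (x ∘ suc) (e j)  ≡⟨ cong₂ _+_ (zeroʳ _) (dot-eʳ (x ∘ suc) j) ⟩
    0# + x (suc j)                     ≡⟨ +-identityˡ _ ⟩
    x (suc j)                          ∎
    where open ≡-Reasoning

  dot-eˡ : ∀ {r} (x : Vec r) j → dot (e j) x ≡ x j
  dot-eˡ x j = trans (dot-comm (e j) x) (dot-eʳ x j)

  dot-▷ : ∀ {t r} (A : Fin t → Fin r → Carrier) x y → dot (A ▷ x) y ≡ dot x ((A ᵀ) ▷ y)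
  dot-▷ A x y = begin
    dot (A ▷ x) y                                ≡⟨ sum-cong-≗ (λ i → cong (_* y i) (▷-dot A x i)) ⟩
    sum (λ i → dot x (A i) * y i)
      ≡⟨ sum-cong-≗ (λ i → *-distribʳ-sum (y i) (λ j → x j * A i j)) ⟩
    sum (λ i → sum (λ j → x j * A i j * y i))    ≡⟨ ∑-comm (λ i j → x j * A i j * y i) ⟩
    sum (λ j → sum (λ i → x j * A i j * y i))    ≡⟨ sum-cong-≗ (λ j → trans
                                                      (sum-cong-≗ (λ i → rearrange (x j) (A i j) (y i)))
                                                      (sym (*-distribˡ-sum (x j) (λ i → y i * A i j)))) ⟩
    sum (λ j → x j * dot y (λ i → A i j))
      ≡⟨ sum-cong-≗ (λ j → cong (x j *_) (▷-dot (A ᵀ) y j)) ⟨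
    dot x ((A ᵀ) ▷ y)                            ∎
    where
    open ≡-Reasoning
    rearrange : ∀ a b c → a * b * c ≡ a * (c * b)
    rearrange a b c = trans (*-assoc a b c) (cong (a *_) (*-comm b c))

  dot-▷ʳ : ∀ {t r} (A : Fin t → Fin r → Carrier) x y → dot x (A ▷ y) ≡ dot ((A ᵀ) ▷ x) y
  dot-▷ʳ A x y = trans (dot-comm x _) (trans (dot-▷ A y x) (dot-comm y _))

  ▷-e : ∀ {t r} (A : Fin t → Fin r → Carrier) j → (A ▷ e j) ≋ (λ i → A i j)
  ▷-e A j i = trans (▷-dot A (e j) i) (dot-eˡ (A i) j)

  lincomb-e : ∀ {r} (x : Vec r) → lincomb x e ≋ x
  lincomb-e {r} x i = begin
    lincomb x e i      ≡⟨ Σ≡sum r _ ⟩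
    dot x (λ j → e j i) ≡⟨ sum-cong-≗ (λ j → cong (x j *_) (e-sym j i)) ⟩
    dot x (e i)        ≡⟨ dot-eʳ x i ⟩
    x i                ∎
    where open ≡-Reasoning

  bil≡dot : ∀ {M} (B : Fin M → Fin M → Carrier) x y → bil B x y ≡ dot x (B ▷ y)
  bil≡dot {M} B x y = begin
    bil B x y                                      ≡⟨ Σ≡sum M _ ⟩
    sum (λ i → Σ[< M ] (λ j → x i * B i j * y j))  ≡⟨ sum-cong-≗ row ⟩
    dot x (B ▷ y)                                  ∎
    where
    open ≡-Reasoning
    row : ∀ i → Σ[< M ] (λ j → x i * B i j * y j) ≡ x i * (B ▷ y) i
    row i = begin
      Σ[< M ] (λ j → x i * B i j * y j)  ≡⟨ Σ≡sum M _ ⟩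
      sum (λ j → x i * B i j * y j)      ≡⟨ sum-cong-≗ (λ j → trans (*-assoc (x i) (B i j) (y j))
                                                                  (cong (x i *_) (*-comm (B i j) (y j)))) ⟩
      sum (λ j → x i * (y j * B i j))    ≡⟨ *-distribˡ-sum (x i) (λ j → y j * B i j) ⟨
      x i * dot y (B i)                  ≡⟨ cong (x i *_) (▷-dot B y i) ⟨
      x i * (B ▷ y) i                    ∎

  lincomb-cong : ∀ {t s} c {vs ws : Fin s → Vec t} → (∀ l → vs l ≋ ws l) → lincomb c vs ≋ lincomb c ws
  lincomb-cong {s = zero}  c h i = refl
  lincomb-cong {s = suc s} c h i = cong₂ _+_ (cong (c zero *_) (h zero i)) (lincomb-cong (c ∘ suc) (h ∘ suc) i)

  record IsLinear {r t} (f : Vec r → Vec t) : Set where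
    field
      resp   : ∀ {x y} → x ≋ y → f x ≋ f y
      ⊕-homo : ∀ x y → f (x ⊕v y) ≋ (f x ⊕v f y)
      ·-homo : ∀ c x → f (c ·v x) ≋ (c ·v f x)

    0-homo : f 0v ≋ 0v
    0-homo = ≋-trans (resp (λ _ → sym (zeroˡ 0#))) (≋-trans (·-homo 0# 0v) (λ i → zeroˡ (f 0v i)))

    ⊖-homo : ∀ x y → f (x ⊖v y) ≋ (f x ⊖v f y)
    ⊖-homo x y = ≋-trans (⊕-homo x _) (⊕v-cong ≋-refl (·-homo (- 1#) y))

    ≋⇒⊖≋0 : ∀ {x y} → f x ≋ f y → f (x ⊖v y) ≋ 0v
    ≋⇒⊖≋0 {x} {y} fx≋fy = ≋-trans (⊖-homo x y) (≋-trans (⊕v-cong fx≋fy ≋-refl) (⊖v-self (f y)))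

    ⊖≋0⇒≋ : ∀ {x y} → f (x ⊖v y) ≋ 0v → f x ≋ f y
    ⊖≋0⇒≋ {x} {y} f[x-y]≋0 = ⊖v-≋0⇒≋ (≋-trans (≋-sym (⊖-homo x y)) f[x-y]≋0)

    lincomb-homo : ∀ {s} c (vs : Fin s → Vec r) → f (lincomb c vs) ≋ lincomb c (f ∘ vs)
    lincomb-homo {zero}  c vs = 0-homo
    lincomb-homo {suc s} c vs =
      ≋-trans (⊕-homo (c zero ·v vs zero) (lincomb (c ∘ suc) (vs ∘ suc)))
              (⊕v-cong (·-homo (c zero) (vs zero)) (lincomb-homo (c ∘ suc) (vs ∘ suc)))

    expand : ∀ x → f x ≋ lincomb x (f ∘ e)
    expand x = ≋-trans (resp (≋-sym (lincomb-e x))) (lincomb-homo x e)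

  linear-ext : ∀ {r t} {f g : Vec r → Vec t} → IsLinear f → IsLinear g →
               (∀ j → f (e j) ≋ g (e j)) → ∀ x → f x ≋ g x
  linear-ext f-lin g-lin agree x =
    ≋-trans (IsLinear.expand f-lin x) (≋-trans (lincomb-cong x agree) (≋-sym (IsLinear.expand g-lin x)))

  id-isLinear : ∀ {r} → IsLinear {r} (λ x → x)
  id-isLinear = record { resp = λ h → h ; ⊕-homo = λ _ _ → ≋-refl ; ·-homo = λ _ _ → ≋-refl }

  0-isLinear : ∀ {r t} → IsLinear {r} {t} (λ _ → 0v)
  0-isLinear = record
    { resp = λ _ → ≋-refl ; ⊕-homo = λ _ _ _ → sym (+-identityʳ 0#) ; ·-homo = λ c _ _ → sym (zeroʳ c) }

  ▷-isLinear : ∀ {t r} (A : Fin t → Fin r → Carrier) → IsLinear (A ▷_)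
  ▷-isLinear A = record
    { resp   = λ {x} {y} h i → trans (▷-dot A x i) (trans (dot-cong h (λ _ → refl)) (sym (▷-dot A y i)))
    ; ⊕-homo = λ x y i → trans (▷-dot A _ i)
                 (trans (dot-⊕ˡ x y (A i)) (sym (cong₂ _+_ (▷-dot A x i) (▷-dot A y i))))
    ; ·-homo = λ c x i → trans (▷-dot A _ i) (trans (dot-·ˡ c x (A i)) (sym (cong (c *_) (▷-dot A x i))))
    }

  ∘-isLinear : ∀ {r s t} {f : Vec s → Vec t} {g : Vec r → Vec s} →
               IsLinear f → IsLinear g → IsLinear (f ∘ g)
  ∘-isLinear f-lin g-lin = record
    { resp   = F.resp ∘ G.resp
    ; ⊕-homo = λ x y → ≋-trans (F.resp (G.⊕-homo x y)) (F.⊕-homo _ _)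
    ; ·-homo = λ c x → ≋-trans (F.resp (G.·-homo c x)) (F.·-homo c _)
    }
    where
    module F = IsLinear f-lin
    module G = IsLinear g-lin

  ⊕-isLinear : ∀ {r t} {f g : Vec r → Vec t} → IsLinear f → IsLinear g → IsLinear (λ x → f x ⊕v g x)
  ⊕-isLinear f-lin g-lin = record
    { resp   = λ h → ⊕v-cong (F.resp h) (G.resp h)
    ; ⊕-homo = λ x y i → trans (cong₂ _+_ (F.⊕-homo x y i) (G.⊕-homo x y i)) (interchange _ _ _ _)
    ; ·-homo = λ c x i → trans (cong₂ _+_ (F.·-homo c x i) (G.·-homo c x i)) (sym (distribˡ c _ _))
    }
    where
    module F = IsLinear f-lin
    module G = IsLinear g-lin

  equalizer-isFSubspace : ∀ {r t} {f g : Vec r → Vec t} → IsLinear f → IsLinear g →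
                          IsFSubspace (λ v → f v ≋ g v)
  equalizer-isFSubspace f-lin g-lin = record
    { resp    = λ u≋v fu≋gu → ≋-trans (≋-sym (F.resp u≋v)) (≋-trans fu≋gu (G.resp u≋v))
    ; has0    = ≋-trans F.0-homo (≋-sym G.0-homo)
    ; closed+ = λ {u} {v} fu≋gu fv≋gv →
                  ≋-trans (F.⊕-homo u v) (≋-trans (⊕v-cong fu≋gu fv≋gv) (≋-sym (G.⊕-homo u v)))
    ; closed· = λ c {v} fv≋gv →
                  ≋-trans (F.·-homo c v) (≋-trans (·v-cong c fv≋gv) (≋-sym (G.·-homo c v)))
    }
    where
    module F = IsLinear f-lin
    module G = IsLinear g-lin

  lincomb-closed : ∀ {t s} {S : Vec t → Set} → IsFSubspace S → {vs : Fin s → Vec t} →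
                   (∀ l → S (vs l)) → ∀ c → S (lincomb c vs)
  lincomb-closed {s = zero}  S-sub vs∈S c = IsFSubspace.has0 S-sub
  lincomb-closed {s = suc s} S-sub vs∈S c = IsFSubspace.closed+ S-sub
    (IsFSubspace.closed· S-sub (c zero) (vs∈S zero)) (lincomb-closed S-sub (vs∈S ∘ suc) (c ∘ suc))

  KMatrix : ∀ {t r} → (Fin t → Fin r → Carrier) → Set
  KMatrix A = ∀ i j → K (A i j)

  K-sum : ∀ {r} {f : Fin r → Carrier} → (∀ i → K (f i)) → K (sum f)
  K-sum {zero}  _   = K-0
  K-sum {suc r} f-K = K-+ (f-K zero) (K-sum (f-K ∘ suc))

  K-dot : ∀ {r} {x y : Vec r} → InK x → InK y → K (dot x y)
  K-dot x-K y-K = K-sum (λ i → K-* (x-K i) (y-K i))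

  InK-▷ : ∀ {t r} {A : Fin t → Fin r → Carrier} → KMatrix A → ∀ {x} → InK x → InK (A ▷ x)
  InK-▷ {A = A} A-K {x} x-K i = subst K (sym (▷-dot A x i)) (K-dot x-K (A-K i))

  InK-⊖ : ∀ {t} {x y : Vec t} → InK x → InK y → InK (x ⊖v y)
  InK-⊖ x-K y-K i = K-+ (x-K i) (K-* (K-neg K-1) (y-K i))

  InK-e : ∀ {r} (j : Fin r) → InK (e j)
  InK-e zero    zero    = K-1
  InK-e zero    (suc i) = K-0
  InK-e (suc j) zero    = K-0
  InK-e (suc j) (suc i) = InK-e j i

  Fsub-⊖ : ∀ {t} {S : Vec t → Set} → IsFSubspace S → ∀ {u v} → S u → S v → S (u ⊖v v)
  Fsub-⊖ S-sub u∈S v∈S = IsFSubspace.closed+ S-sub u∈S (IsFSubspace.closed· S-sub (- 1#) v∈S)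

  Ksub-⊖ : ∀ {t} {S : Vec t → Set} → IsKSubspace S → ∀ {u v} → S u → S v → S (u ⊖v v)
  Ksub-⊖ S-sub u∈S v∈S = IsKSubspace.closed+ S-sub u∈S (IsKSubspace.closed· S-sub (K-neg K-1) v∈S)

  injectiveOnW : ∀ {r t} {f : Vec r → Vec t} → IsLinear f → (∀ x → InK x → f x ≋ 0v → x ≋ 0v) →
                 ∀ {x y} → InK x → InK y → f x ≋ f y → x ≋ y
  injectiveOnW f-lin ker∩W≡0 x-K y-K fx≋fy =
    ⊖v-≋0⇒≋ (ker∩W≡0 _ (InK-⊖ x-K y-K) (IsLinear.≋⇒⊖≋0 f-lin fx≋fy))

  columns⇒rightInverse : ∀ {t r} (A : Fin t → Fin r → Carrier) (columns : Fin t → Vec r) →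
                         (∀ j → (A ▷ columns j) ≋ e j) → ∀ v → (A ▷ (mat columns ▷ v)) ≋ v
  columns⇒rightInverse A columns hit =
    linear-ext (∘-isLinear (▷-isLinear A) (▷-isLinear (mat columns))) id-isLinear
    (λ j → ≋-trans (IsLinear.resp (▷-isLinear A) (▷-e (mat columns) j)) (hit j))

  rightInverse⇒ᵀ-injective : ∀ {t r} (A : Fin t → Fin r → Carrier) (C : Fin r → Fin t → Carrier) →
                             (∀ v → (A ▷ (C ▷ v)) ≋ v) → ∀ x → ((A ᵀ) ▷ x) ≋ 0v → x ≋ 0v
  rightInverse⇒ᵀ-injective A C AC≋id x Aᵀx≋0 j = begin
    x j                          ≡⟨ dot-eʳ x j ⟨
    dot x (e j)                  ≡⟨ dot-cong (λ _ → refl) (AC≋id (e j)) ⟨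
    dot x (A ▷ (C ▷ e j))        ≡⟨ dot-▷ʳ A x (C ▷ e j) ⟩
    dot ((A ᵀ) ▷ x) (C ▷ e j)    ≡⟨ dot-cong Aᵀx≋0 (λ _ → refl) ⟩
    dot 0v (C ▷ e j)             ≡⟨ dot-0ˡ (C ▷ e j) ⟩
    0#                           ∎
    where open ≡-Reasoning

  -- W = K^M is in bijection with Fin (q ^ M), so A, being injective on W, is onto W.
  module _ {M} (A : Fin M → Fin M → Carrier) (A-K : KMatrix A)
           (ker∩W≡0 : ∀ x → InK x → (A ▷ x) ≋ 0v → x ≋ 0v) where
    private
      embed-K : (a : Fin M → Fin q) → InK (ι ∘ a)
      embed-K a i = a i , refl

      act : (Fin M → Fin q) → Fin M → Fin q
      act a i = proj₁ (InK-▷ A-K (embed-K a) i)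

      ι-act : ∀ a → (ι ∘ act a) ≋ (A ▷ (ι ∘ a))
      ι-act a i = proj₂ (InK-▷ A-K (embed-K a) i)

      encodedAct : Fin (q ^ M) → Fin (q ^ M)
      encodedAct = funToFin ∘ act ∘ finToFun

      encodedAct-injective : Injective _≡_ _≡_ encodedAct
      encodedAct-injective {a} {b} eq = begin
        a                                 ≡⟨ funToFin-finToFin {M} {q} a ⟨
        funToFin (finToFun {q} {M} a)     ≡⟨ funToFin-cong (λ i → ι-inj (same-embedding i)) ⟩
        funToFin (finToFun {q} {M} b)     ≡⟨ funToFin-finToFin {M} {q} b ⟩
        b                                 ∎
        where
        open ≡-Reasoning
        same-action : (A ▷ (ι ∘ finToFun a)) ≋ (A ▷ (ι ∘ finToFun b))
        same-action i = trans (sym (ι-act _ i)) (trans (cong ι (funToFin-injective eq i)) (ι-act _ i))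
        same-embedding : (ι ∘ finToFun a) ≋ (ι ∘ finToFun b)
        same-embedding = injectiveOnW (▷-isLinear A) ker∩W≡0 (embed-K _) (embed-K _) same-action

    K-injective⇒K-surjective : ∀ y → InK y → ∃[ x ] (InK x × (A ▷ x) ≋ y)
    K-injective⇒K-surjective y y-K = ι ∘ finToFun x , embed-K _ , hit
      where
      preimage = Fin-injective⇒surjective encodedAct encodedAct-injective (funToFin (proj₁ ∘ y-K))
      x = proj₁ preimage
      hit : (A ▷ (ι ∘ finToFun x)) ≋ y
      hit i = trans (sym (ι-act _ i)) (trans (cong ι (funToFin-injective (proj₂ preimage) i)) (proj₂ (y-K i)))

    -- abstract, so that users never unfold the inverse into the counting argument
    abstract
      K-injective⇒rightInverse :
        Σ (Fin M → Fin M → Carrier) λ C → KMatrix C × (∀ v → (A ▷ (C ▷ v)) ≋ v)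
      K-injective⇒rightInverse = mat columns , (λ i j → proj₁ (proj₂ (preimage j)) i) ,
        columns⇒rightInverse A columns (λ j → proj₂ (proj₂ (preimage j)))
        where
        preimage : ∀ j → ∃[ x ] (InK x × (A ▷ x) ≋ e j)
        preimage j = K-injective⇒K-surjective (e j) (InK-e j)
        columns : Fin M → Vec M
        columns j = proj₁ (preimage j)

  differ-on-basis : ∀ {r t} {f g : Vec r → Vec t} → IsLinear f → IsLinear g →
                    ¬ (∀ x → f x ≋ g x) → ∃[ j ] ¬ (f (e j) ≋ g (e j))
  differ-on-basis {r} {f = f} {g} f-lin g-lin f≉g with all? (λ j → f (e j) ≋? g (e j))
  ... | yes agree    = ⊥-elim (f≉g (linear-ext f-lin g-lin agree))
  ... | no  disagree = ¬∀⟶∃¬ r _ (λ j → f (e j) ≋? g (e j)) disagree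

  decomposable-by-projection : ∀ {k} {U : Vec k → Set} → IsKSubspace U →
    ∀ {π : Vec k → Vec k} → IsLinear π → (∀ v → π (π v) ≋ π v) → (∀ u → U u → U (π u)) →
    ¬ (∀ v → π v ≋ 0v) → ¬ (∀ v → π v ≋ v) → Decomposable k U
  decomposable-by-projection {k} U-sub {π} π-lin π-idem π-U π≢0 π≢id =
    Fixed , Kernel , equalizer-isFSubspace π-lin id-isLinear , equalizer-isFSubspace π-lin 0-isLinear ,
    fixed≢0 , kernel≢0 , (λ v πv≋v πv≋0 → ≋-trans (≋-sym πv≋v) πv≋0) ,
    (λ v → π v , v ⊖v π v , π-idem v , π-kills-rest v , ≋-sym (reassemble v)) ,
    (λ u u∈U → π u , u ⊖v π u , π-U u u∈U , π-idem u ,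
               Ksub-⊖ U-sub u∈U (π-U u u∈U) , π-kills-rest u , ≋-sym (reassemble u))
    where
    Fixed Kernel : Vec k → Set
    Fixed  v = π v ≋ v
    Kernel v = π v ≋ 0v

    π-kills-rest : ∀ v → Kernel (v ⊖v π v)
    π-kills-rest v = IsLinear.≋⇒⊖≋0 π-lin (≋-sym (π-idem v))

    reassemble : ∀ v → (π v ⊕v (v ⊖v π v)) ≋ v
    reassemble v i = x+[y-x]≡y (π v i) (v i)

    fixed≢0 : NonZero Fixed
    fixed≢0 = let (j , πe≉0) = differ-on-basis π-lin 0-isLinear π≢0 in π (e j) , π-idem (e j) , πe≉0

    kernel≢0 : NonZero Kernel
    kernel≢0 = let (j , πe≉e) = differ-on-basis π-lin id-isLinear π≢id in
      e j ⊖v π (e j) , π-kills-rest (e j) , λ rest≋0 → πe≉e (≋-sym (⊖v-≋0⇒≋ rest≋0))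

  KIndependent₂ : ∀ {t} → Vec t → Vec t → Set
  KIndependent₂ b₀ b₁ =
    ∀ {α β} → K α → K β → ((α ·v b₀) ⊕v (β ·v b₁)) ≋ 0v → α ≡ 0# × β ≡ 0#

  decomposable-by-functional : ∀ {k} {U : Vec k → Set} → IsKSubspace U →
    ∀ {b₀ b₁} → U b₀ → U b₁ → KIndependent₂ b₀ b₁ →
    (a : Vec k) → (∀ u → U u → K (dot a u)) → ∀ {u₀} → U u₀ → dot a u₀ ≢ 0# → Decomposable k U
  decomposable-by-functional {k} {U} U-sub {b₀} {b₁} b₀∈U b₁∈U indep a a-K {u₀} u₀∈U au₀≢0 =
    decomposable-by-projection U-sub π-lin π-idem π-U π≢0 π≢id
    where
    au₀⁻¹ = proj₁ (inverse (dot a u₀) au₀≢0)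

    u : Vec k
    u = au₀⁻¹ ·v u₀

    au≡1 : dot a u ≡ 1#
    au≡1 = trans (dot-·ʳ au₀⁻¹ a u₀) (trans (*-comm au₀⁻¹ _) (proj₂ (inverse _ au₀≢0)))

    u∈U : U u
    u∈U = IsKSubspace.closed· U-sub (K-inv (a-K u₀ u₀∈U) (proj₂ (inverse _ au₀≢0))) u₀∈U

    π : Vec k → Vec k
    π v = dot a v ·v u

    π-lin : IsLinear π
    π-lin = record
      { resp   = λ h i → cong (_* u i) (dot-cong (λ _ → refl) h)
      ; ⊕-homo = λ x y i → trans (cong (_* u i) (dot-⊕ʳ a x y)) (distribʳ (u i) _ _)
      ; ·-homo = λ c x i → trans (cong (_* u i) (dot-·ʳ c a x)) (*-assoc c _ _)
      }

    π-idem : ∀ v → π (π v) ≋ π v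
    π-idem v i = cong (_* u i) (trans (dot-·ʳ (dot a v) a u) (trans (cong (dot a v *_) au≡1) (*-identityʳ _)))

    π-U : ∀ v → U v → U (π v)
    π-U v v∈U = IsKSubspace.closed· U-sub (a-K v v∈U) u∈U

    π≢0 : ¬ (∀ v → π v ≋ 0v)
    π≢0 π≋0 = 0≢1 (begin
      0#        ≡⟨ dot-0ʳ a ⟨
      dot a 0v  ≡⟨ dot-cong (λ _ → refl) u≋0 ⟨
      dot a u   ≡⟨ au≡1 ⟩
      1#        ∎)
      where
      open ≡-Reasoning
      u≋0 : u ≋ 0v
      u≋0 i = trans (sym (*-identityˡ (u i))) (trans (cong (_* u i) (sym au≡1)) (π≋0 u i))

    -- (a·b₁) b₀ - (a·b₀) b₁ is killed by a; if π were the identity it would vanish, forcing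
    -- a·b₁ = 0 and then b₁ = π b₁ = 0.
    π≢id : ¬ (∀ v → π v ≋ v)
    π≢id π≋id = 0≢1 (sym (proj₂ (indep K-0 K-1 only-b₁≋0)))
      where
      v : Vec k
      v = (dot a b₁ ·v b₀) ⊕v ((- 1# * dot a b₀) ·v b₁)

      av≡0 : dot a v ≡ 0#
      av≡0 = trans (dot-⊕ʳ a _ _)
        (trans (cong₂ _+_ (dot-·ʳ _ a b₀) (dot-·ʳ _ a b₁)) (xy-yx≡0 (dot a b₁) (dot a b₀)))

      killed≋0 : ∀ {w} → dot a w ≡ 0# → w ≋ 0v
      killed≋0 {w} aw≡0 i = trans (sym (π≋id w i)) (trans (cong (_* u i) aw≡0) (zeroˡ (u i)))

      ab₁≡0 : dot a b₁ ≡ 0#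
      ab₁≡0 = proj₁ (indep (a-K b₁ b₁∈U) (K-* (K-neg K-1) (a-K b₀ b₀∈U)) (killed≋0 av≡0))

      only-b₁≋0 : ((0# ·v b₀) ⊕v (1# ·v b₁)) ≋ 0v
      only-b₁≋0 i = trans (cong₂ _+_ (zeroˡ (b₀ i)) (trans (*-identityˡ (b₁ i)) (killed≋0 ab₁≡0 i)))
                          (+-identityˡ 0#)

  two-independent : ∀ {t M} {S : Vec t → Set} → 2 ≤ M → HasKDim S M →
                    ∃[ b₀ ] ∃[ b₁ ] (S b₀ × S b₁ × KIndependent₂ b₀ b₁)
  two-independent {M = suc (suc M)} (s≤s (s≤s _)) (b , b∈S , b-indep , _) =
    b zero , b (suc zero) , b∈S zero , b∈S (suc zero) ,
    λ α-K β-K comb≋0 → let c≡0 = b-indep _ (coefficients-K α-K β-K) (≋-trans (lincomb-pair _ _) comb≋0) in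
      c≡0 zero , c≡0 (suc zero)
    where
    coefficients : Carrier → Carrier → Vec (suc (suc M))
    coefficients α β zero          = α
    coefficients α β (suc zero)    = β
    coefficients α β (suc (suc _)) = 0#

    coefficients-K : ∀ {α β} → K α → K β → InK (coefficients α β)
    coefficients-K α-K β-K zero          = α-K
    coefficients-K α-K β-K (suc zero)    = β-K
    coefficients-K α-K β-K (suc (suc _)) = K-0

    lincomb-pair : ∀ α β → lincomb (coefficients α β) b ≋ ((α ·v b zero) ⊕v (β ·v b (suc zero)))
    lincomb-pair α β i = cong (α * b zero i +_) (trans
      (cong (β * b (suc zero) i +_) (IsLinear.0-homo (▷-isLinear {r = M} (mat (λ l → b (suc (suc l))))) i))
      (+-identityʳ _))

  module Duality {k M k' : ℕ} {U : Vec k → Set} (D : DelsarteData k M k' U) where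
    open DelsarteData D

    Γ Γ⊥ : Vec M → Set
    Γ  z = (G ▷ z) ≋ 0v
    Γ⊥ z = (H ▷ z) ≋ 0v

    β : Vec M → Vec M → Carrier
    β x y = dot x (B ▷ y)

    Γ⊥⊥Γ : ∀ {z γ} → Γ⊥ z → Γ γ → β z γ ≡ 0#
    Γ⊥⊥Γ {z} {γ} z∈Γ⊥ γ∈Γ = trans (sym (bil≡dot B z γ)) (H-ker→ z z∈Γ⊥ γ γ∈Γ)

    β-⊖ʳ : ∀ x y y' → β x (y ⊖v y') ≡ β x y + - 1# * β x y'
    β-⊖ʳ x y y' = trans (dot-cong (λ _ → refl) (IsLinear.⊖-homo (▷-isLinear B) y y')) (dot-⊖ʳ x _ _)

    β-0ʳ : ∀ x → β x 0v ≡ 0#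
    β-0ʳ x = trans (dot-cong (λ _ → refl) (IsLinear.0-homo (▷-isLinear B))) (dot-0ʳ x)

    β-e : ∀ x j → β x (e j) ≡ ((B ᵀ) ▷ x) j
    β-e x j = trans (dot-cong (λ _ → refl) (▷-e B j)) (sym (▷-dot (B ᵀ) x j))

    Bᵀ-ker∩W≡0 : ∀ x → InK x → ((B ᵀ) ▷ x) ≋ 0v → x ≋ 0v
    Bᵀ-ker∩W≡0 x x-K Bᵀx≋0 = B-nondeg x x-K (λ y _ → begin
      bil B x y          ≡⟨ bil≡dot B x y ⟩
      dot x (B ▷ y)      ≡⟨ dot-▷ʳ B x y ⟩
      dot ((B ᵀ) ▷ x) y  ≡⟨ dot-cong Bᵀx≋0 (λ _ → refl) ⟩
      dot 0v y           ≡⟨ dot-0ˡ y ⟩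
      0#                 ∎)
      where open ≡-Reasoning

    Bᵀ-rightInverse : Σ (Fin M → Fin M → Carrier) λ C → KMatrix C × (∀ v → ((B ᵀ) ▷ (C ▷ v)) ≋ v)
    Bᵀ-rightInverse = K-injective⇒rightInverse (B ᵀ) (λ i j → B-K j i) Bᵀ-ker∩W≡0

    B-injective : ∀ x → (B ▷ x) ≋ 0v → x ≋ 0v
    B-injective = rightInverse⇒ᵀ-injective (B ᵀ) (proj₁ Bᵀ-rightInverse) (proj₂ (proj₂ Bᵀ-rightInverse))

    B-rightInverse : Σ (Fin M → Fin M → Carrier) λ C → KMatrix C × (∀ v → (B ▷ (C ▷ v)) ≋ v)
    B-rightInverse = K-injective⇒rightInverse B B-K (λ x _ → B-injective x)

    B⁻¹ : Fin M → Fin M → Carrier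
    B⁻¹ = proj₁ B-rightInverse

    B⁻¹-K : KMatrix B⁻¹
    B⁻¹-K = proj₁ (proj₂ B-rightInverse)

    B-B⁻¹ : ∀ v → (B ▷ (B⁻¹ ▷ v)) ≋ v
    B-B⁻¹ = proj₂ (proj₂ B-rightInverse)

    Bᵀ-injective : ∀ x → ((B ᵀ) ▷ x) ≋ 0v → x ≋ 0v
    Bᵀ-injective = rightInverse⇒ᵀ-injective B B⁻¹ B-B⁻¹

    β-determined : ∀ {x x'} → (∀ j → β x (e j) ≡ β x' (e j)) → x ≋ x'
    β-determined {x} {x'} agree = ⊖v-≋0⇒≋ (Bᵀ-injective _ (IsLinear.≋⇒⊖≋0 (▷-isLinear (B ᵀ))
      (λ j → trans (sym (β-e x j)) (trans (agree j) (β-e x' j)))))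

    Γ⊥⊥⊆Γ : ∀ x → (∀ t → Γ⊥ t → β t x ≡ 0#) → Γ x
    Γ⊥⊥⊆Γ x x⊥Γ⊥ i = trans (sym (probe x)) (x⊥Γ⊥ t t∈Γ⊥)
      where
      t : Vec M
      t = proj₁ Bᵀ-rightInverse ▷ ((G ᵀ) ▷ e i)

      probe : ∀ y → β t y ≡ (G ▷ y) i
      probe y = begin
        dot t (B ▷ y)          ≡⟨ dot-▷ʳ B t y ⟩
        dot ((B ᵀ) ▷ t) y      ≡⟨ dot-cong (proj₂ (proj₂ Bᵀ-rightInverse) _) (λ _ → refl) ⟩
        dot ((G ᵀ) ▷ e i) y    ≡⟨ dot-▷ (G ᵀ) (e i) y ⟩
        dot (e i) (G ▷ y)      ≡⟨ dot-eˡ (G ▷ y) i ⟩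
        (G ▷ y) i              ∎
        where open ≡-Reasoning

      t∈Γ⊥ : Γ⊥ t
      t∈Γ⊥ = H-ker← t (λ γ γ∈Γ → trans (bil≡dot B t γ) (trans (probe γ) (γ∈Γ i)))

    S : Fin M → Fin k → Carrier
    S = mat (λ j → proj₁ (G-surj (e j)))

    S-section : ∀ v → (G ▷ (S ▷ v)) ≋ v
    S-section = columns⇒rightInverse G _ (λ j → proj₂ (G-surj (e j)))

    module _ (U-sub : IsKSubspace U) {b₀ b₁} (b₀∈U : U b₀) (b₁∈U : U b₁)
             (indep : KIndependent₂ b₀ b₁) (U-indec : Indecomposable k U) where

      W∩Γ⊥≡0 : ∀ w → InK w → Γ⊥ w → w ≋ 0v
      W∩Γ⊥≡0 w w-K w∈Γ⊥ = Bᵀ-ker∩W≡0 w w-K (λ j → trans (sym (β-e w j)) (βwe≡0 j))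
        where
        a : Vec k
        a = (S ᵀ) ▷ ((B ᵀ) ▷ w)

        a∘G≡β : ∀ y → dot a (G ▷ y) ≡ β w y
        a∘G≡β y = begin
          dot a (G ▷ y)                  ≡⟨ dot-▷ (S ᵀ) _ (G ▷ y) ⟩
          dot ((B ᵀ) ▷ w) (S ▷ (G ▷ y))  ≡⟨ dot-▷ (B ᵀ) w _ ⟩
          β w (S ▷ (G ▷ y))              ≡⟨ x-y≡0⇒x≡y (trans (sym (β-⊖ʳ w _ y)) (Γ⊥⊥Γ w∈Γ⊥
                                              (IsLinear.≋⇒⊖≋0 (▷-isLinear G) (S-section (G ▷ y))))) ⟩
          β w y                          ∎
          where open ≡-Reasoning

        a-K : ∀ u → U u → K (dot a u)
        a-K u u∈U with G-W-onto u u∈U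
        ... | w' , w'-K , Gw'≋u = subst K (trans (sym (a∘G≡β w')) (dot-cong (λ _ → refl) Gw'≋u))
                                          (K-dot w-K (InK-▷ B-K w'-K))

        βwe≡0 : ∀ j → β w (e j) ≡ 0#
        βwe≡0 j with β w (e j) ≟ 0#
        ... | yes βwe≡0 = βwe≡0
        ... | no  βwe≢0 = ⊥-elim (U-indec (decomposable-by-functional U-sub b₀∈U b₁∈U indep a a-K
                            (G-W-into (e j) (InK-e j)) (λ eq → βwe≢0 (trans (sym (a∘G≡β (e j))) eq))))

      module Lift (V₁ V₂ : Vec k' → Set) (V₁-sub : IsFSubspace V₁) (V₂-sub : IsFSubspace V₂)
                  (V₁≢0 : NonZero V₁) (V₂≢0 : NonZero V₂)
                  (V₁∩V₂≡0 : ∀ v → V₁ v → V₂ v → v ≋ 0v)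
                  (Dual-splits : ∀ u → Dual u →
                     ∃[ u₁ ] ∃[ u₂ ] (Dual u₁ × V₁ u₁ × Dual u₂ × V₂ u₂ × u ≋ (u₁ ⊕v u₂))) where

        0∈V₁ : V₁ 0v
        0∈V₁ = IsFSubspace.has0 V₁-sub

        0∈V₂ : V₂ 0v
        0∈V₂ = IsFSubspace.has0 V₂-sub

        component-unique : ∀ {a c a' c'} → V₁ a → V₂ c → V₁ a' → V₂ c' →
                           (a ⊕v c) ≋ (a' ⊕v c') → a ≋ a'
        component-unique a∈V₁ c∈V₂ a'∈V₁ c'∈V₂ same-sum =
          ⊖v-≋0⇒≋ (V₁∩V₂≡0 _ (Fsub-⊖ V₁-sub a∈V₁ a'∈V₁) (IsFSubspace.resp V₂-sub
            (λ i → sym (x+y≡x'+y'⇒x-x'≡y'-y (same-sum i))) (Fsub-⊖ V₂-sub c'∈V₂ c∈V₂)))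

        record Lifted (i : Fin M) : Set where
          field
            w       : Vec M
            w∈W     : InK w
            rest    : Vec k'
            Hw∈V₁   : V₁ (H ▷ w)
            rest∈V₂ : V₂ rest
            He≋     : (H ▷ e i) ≋ ((H ▷ w) ⊕v rest)

        lift : ∀ i → Lifted i
        lift i with Dual-splits (H ▷ e i) (e i , InK-e i , λ _ → refl)
        ... | u₁ , u₂ , (w , w∈W , Hw≋u₁) , u₁∈V₁ , _ , u₂∈V₂ , He≋ = record
          { w = w ; w∈W = w∈W ; rest = u₂ ; Hw∈V₁ = IsFSubspace.resp V₁-sub (≋-sym Hw≋u₁) u₁∈V₁
          ; rest∈V₂ = u₂∈V₂ ; He≋ = ≋-trans He≋ (⊕v-cong (≋-sym Hw≋u₁) ≋-refl) }

        open Lifted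

        P : Fin M → Fin M → Carrier
        P = mat (w ∘ lift)

        P-K : KMatrix P
        P-K i j = w∈W (lift j) i

        R : Fin k' → Fin M → Carrier
        R = mat (rest ∘ lift)

        HP∈V₁ : ∀ z → V₁ (H ▷ (P ▷ z))
        HP∈V₁ z = IsFSubspace.resp V₁-sub (≋-sym (IsLinear.lincomb-homo (▷-isLinear H) z (w ∘ lift)))
                    (lincomb-closed V₁-sub (Hw∈V₁ ∘ lift) z)

        R∈V₂ : ∀ z → V₂ (R ▷ z)
        R∈V₂ z = lincomb-closed V₂-sub (rest∈V₂ ∘ lift) z

        H-splits : ∀ z → (H ▷ z) ≋ ((H ▷ (P ▷ z)) ⊕v (R ▷ z))
        H-splits = linear-ext (▷-isLinear H)
          (⊕-isLinear (∘-isLinear (▷-isLinear H) (▷-isLinear P)) (▷-isLinear R))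
          (λ j → ≋-trans (He≋ (lift j))
                   (⊕v-cong (IsLinear.resp (▷-isLinear H) (≋-sym (▷-e P j))) (≋-sym (▷-e R j))))

        P-Γ⊥ : ∀ z → Γ⊥ z → Γ⊥ (P ▷ z)
        P-Γ⊥ z z∈Γ⊥ = component-unique (HP∈V₁ z) (R∈V₂ z) 0∈V₁ 0∈V₂
          (≋-trans (≋-sym (H-splits z)) (≋-trans z∈Γ⊥ (λ _ → sym (+-identityʳ 0#))))

        P-idem : ∀ z → (P ▷ (P ▷ z)) ≋ (P ▷ z)
        P-idem = linear-ext (∘-isLinear (▷-isLinear P) (▷-isLinear P)) (▷-isLinear P)
                            (λ j → P-idemOnW (InK-e j))
          where
          P-idemOnW : ∀ {z} → InK z → (P ▷ (P ▷ z)) ≋ (P ▷ z)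
          P-idemOnW {z} z-K =
            injectiveOnW (▷-isLinear H) W∩Γ⊥≡0 (InK-▷ P-K (InK-▷ P-K z-K)) (InK-▷ P-K z-K)
              (≋-sym (component-unique (HP∈V₁ z) 0∈V₂ (HP∈V₁ (P ▷ z)) (R∈V₂ (P ▷ z))
                        (≋-trans (λ i → +-identityʳ _) (H-splits (P ▷ z)))))

        Q : Vec M → Vec M
        Q y = B⁻¹ ▷ ((P ᵀ) ▷ (B ▷ y))

        Q-lin : IsLinear Q
        Q-lin = ∘-isLinear (▷-isLinear B⁻¹) (∘-isLinear (▷-isLinear (P ᵀ)) (▷-isLinear B))

        Q-W : ∀ {y} → InK y → InK (Q y)
        Q-W y-K = InK-▷ B⁻¹-K (InK-▷ (λ i j → P-K j i) (InK-▷ B-K y-K))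

        Q-adjoint : ∀ z y → β z (Q y) ≡ β (P ▷ z) y
        Q-adjoint z y = trans (dot-cong (λ _ → refl) (B-B⁻¹ _)) (sym (dot-▷ P z (B ▷ y)))

        Q-Γ : ∀ y → Γ y → Γ (Q y)
        Q-Γ y y∈Γ = Γ⊥⊥⊆Γ (Q y) (λ t t∈Γ⊥ → trans (Q-adjoint t y) (Γ⊥⊥Γ (P-Γ⊥ t t∈Γ⊥) y∈Γ))

        Q-idem-mod-Γ : ∀ y → (G ▷ Q (Q y)) ≋ (G ▷ Q y)
        Q-idem-mod-Γ y = IsLinear.⊖≋0⇒≋ (▷-isLinear G) (Γ⊥⊥⊆Γ _ (λ t _ → begin
          β t (Q (Q y) ⊖v Q y)                     ≡⟨ β-⊖ʳ t _ _ ⟩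
          β t (Q (Q y)) + - 1# * β t (Q y)
            ≡⟨ cong₂ (λ a b → a + - 1# * b) (trans (Q-adjoint t _) (Q-adjoint (P ▷ t) y)) (Q-adjoint t y) ⟩
          β (P ▷ (P ▷ t)) y + - 1# * β (P ▷ t) y
            ≡⟨ cong (_+ - 1# * β (P ▷ t) y) (dot-cong (P-idem t) (λ _ → refl)) ⟩
          β (P ▷ t) y + - 1# * β (P ▷ t) y         ≡⟨ x-x≡0 _ ⟩
          0#                                       ∎))
          where open ≡-Reasoning

        π : Vec k → Vec k
        π v = G ▷ Q (S ▷ v)

        π-lin : IsLinear π
        π-lin = ∘-isLinear (▷-isLinear G) (∘-isLinear Q-lin (▷-isLinear S))

        π∘G≋G∘Q : ∀ y → π (G ▷ y) ≋ (G ▷ Q y)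
        π∘G≋G∘Q y = IsLinear.⊖≋0⇒≋ (∘-isLinear (▷-isLinear G) Q-lin)
          (Q-Γ _ (IsLinear.≋⇒⊖≋0 (▷-isLinear G) (S-section (G ▷ y))))

        π-idem : ∀ v → π (π v) ≋ π v
        π-idem v = ≋-trans (π∘G≋G∘Q (Q (S ▷ v))) (Q-idem-mod-Γ (S ▷ v))

        π-U : ∀ u → U u → U (π u)
        π-U u u∈U = landed (G-W-onto u u∈U)
          where
          landed : ∃[ w ] (InK w × (G ▷ w) ≋ u) → U (π u)
          landed (w , w∈W , Gw≋u) = IsKSubspace.resp U-sub step (G-W-into (Q w) (Q-W w∈W))
            where
            step : (G ▷ Q w) ≋ π u
            step = ≋-trans (≋-sym (π∘G≋G∘Q w)) (IsLinear.resp π-lin Gw≋u)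

        π≢0 : ¬ (∀ v → π v ≋ 0v)
        π≢0 π≋0 = v≉0 (≋-trans (component-unique v∈V₁ 0∈V₂ (HP∈V₁ z) (R∈V₂ z) v⊕0≋HPz⊕Rz)
                               (≋-trans (IsLinear.resp (▷-isLinear H) (P≋0 z)) (IsLinear.0-homo (▷-isLinear H))))
          where
          Qe≋0 : ∀ j → Q (e j) ≋ 0v
          Qe≋0 j = injectiveOnW (▷-isLinear G) W∩Γ≡0 (Q-W (InK-e j)) (λ _ → K-0)
            (≋-trans (≋-sym (π∘G≋G∘Q (e j)))
                     (≋-trans (π≋0 _) (≋-sym (IsLinear.0-homo (▷-isLinear G)))))

          P≋0 : ∀ z → (P ▷ z) ≋ 0v
          P≋0 z = β-determined (λ j → trans (sym (Q-adjoint z (e j)))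
            (trans (dot-cong (λ _ → refl) (IsLinear.resp (▷-isLinear B) (Qe≋0 j)))
                   (trans (β-0ʳ z) (sym (dot-0ˡ (B ▷ e j))))))

          v = proj₁ V₁≢0
          v∈V₁ = proj₁ (proj₂ V₁≢0)
          v≉0 = proj₂ (proj₂ V₁≢0)
          z = proj₁ (H-surj v)

          v⊕0≋HPz⊕Rz : (v ⊕v 0v) ≋ ((H ▷ (P ▷ z)) ⊕v (R ▷ z))
          v⊕0≋HPz⊕Rz = ≋-trans (λ i → +-identityʳ (v i)) (≋-trans (≋-sym (proj₂ (H-surj v))) (H-splits z))

        π≢id : ¬ (∀ v → π v ≋ v)
        π≢id π≋id = v≉0 (≋-sym (≋-trans (component-unique 0∈V₁ v∈V₂ (HP∈V₁ z) (R∈V₂ z) 0⊕v≋HPz⊕Rz)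
                                        (≋-trans (IsLinear.resp (▷-isLinear H) (P≋id z)) (proj₂ (H-surj v)))))
          where
          Qe≋e : ∀ j → Q (e j) ≋ e j
          Qe≋e j = injectiveOnW (▷-isLinear G) W∩Γ≡0 (Q-W (InK-e j)) (InK-e j)
            (≋-trans (≋-sym (π∘G≋G∘Q (e j))) (π≋id _))

          P≋id : ∀ z → (P ▷ z) ≋ z
          P≋id z = β-determined (λ j → trans (sym (Q-adjoint z (e j)))
            (dot-cong (λ _ → refl) (IsLinear.resp (▷-isLinear B) (Qe≋e j))))

          v = proj₁ V₂≢0
          v∈V₂ = proj₁ (proj₂ V₂≢0)
          v≉0 = proj₂ (proj₂ V₂≢0)
          z = proj₁ (H-surj v)

          0⊕v≋HPz⊕Rz : (0v ⊕v v) ≋ ((H ▷ (P ▷ z)) ⊕v (R ▷ z))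
          0⊕v≋HPz⊕Rz =
            ≋-trans (λ i → +-identityˡ (v i)) (≋-trans (≋-sym (proj₂ (H-surj v))) (H-splits z))

        U-decomposable : Decomposable k U
        U-decomposable = decomposable-by-projection U-sub π-lin π-idem π-U π≢0 π≢id

      Dual-indecomposable : Indecomposable k' Dual
      Dual-indecomposable (V₁ , V₂ , V₁-sub , V₂-sub , V₁≢0 , V₂≢0 , V₁∩V₂≡0 , _ , Dual-splits) =
        U-indec (Lift.U-decomposable V₁ V₂ V₁-sub V₂-sub V₁≢0 V₂≢0 V₁∩V₂≡0 Dual-splits)

open import Data.Nat using (_*_; _∸_; _>_)

proposition3p7 : (q n m k : ℕ) → IsPrimePower q → n > 0 → m > 0 → k > 0 → n * m > k →
    (E : FieldExt q n) → let open LinAlg E in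
    (U : Vec k → Set) → IsKSubspace U → HasKDim U (n * m) → FSpansAll U →
    Indecomposable k U →
    (D : DelsarteData k (n * m) (n * m ∸ k) U) →
    Indecomposable (n * m ∸ k) (DelsarteData.Dual D)
proposition3p7 q n m k _ _ _ k>0 nm>k E U U-sub U-dim _ U-indec D =
  let (_ , _ , b₀∈U , b₁∈U , indep) = two-independent (≤-trans (s≤s k>0) nm>k) U-dim
  in Duality.Dual-indecomposable D U-sub b₀∈U b₁∈U indep U-indec
  where open LinearAlgebra E
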